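{- Let $q$ be a power of an odd prime $p$, and let \[ h(t)=\frac{(t-2)(t^{q^2-1}-1)}{(t^{q-1}-1)(t^q-t^{q-1}-1)}\in\mathbb F_p(t). \] Then \[ h(t)=t^{(q-1)^2}+\sum_{\substack{\alpha,\beta\in\mathbb Z,\ \alpha,\beta\ge0\\ \beta\le q-2\\ 0<\alpha+\beta\le q-1}}\Bigl[2^{\alpha+\beta}\binom{2(q-1)-\alpha-\beta}{q-1}-\binom{\alpha+\beta}{\alpha}\Bigr]t^{(q-1)^2-(\alpha+\beta q)}. \]
   Context: Binomial coefficients $\binom mk$ (for integers $m\ge0$, $k\ge 0$, with $\binom mk=0$ if $k>m$) and powers of $2$ are read in $\mathbb F_p$. -}

module Defs where

open import Data.Nat as ℕ using (ℕ; zero; suc; _∸_; _^_; _<ᵇ_; _≤ᵇ_)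
open import Data.Nat.Combinatorics using (_C_)
open import Data.Integer as ℤ using (ℤ; +_; -[1+_])
open import Data.Integer.Divisibility as ℤD using ()
open import Data.List using (List; []; _∷_; map; replicate; _++_; foldr; concatMap; upTo)
open import Data.Bool using (if_then_else_; _∧_)

-- Polynomials with integer coefficients, as coefficient lists
-- (entry i = coefficient of t^i). They are read in F_p[t] by
-- reducing coefficients mod p (see _≡[mod_]_ below).
Poly : Set
Poly = List ℤ

coeff : Poly → ℕ → ℤ
coeff []      _       = + 0
coeff (a ∷ f) zero    = a
coeff (a ∷ f) (suc n) = coeff f n

infixl 6 _+P_
infixl 7 _*P_

_+P_ : Poly → Poly → Poly
[]      +P g       = g
(a ∷ f) +P []      = a ∷ f
(a ∷ f) +P (b ∷ g) = (a ℤ.+ b) ∷ (f +P g)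

_*P_ : Poly → Poly → Poly
[]      *P g = []
(a ∷ f) *P g = map (a ℤ.*_) g +P (+ 0 ∷ (f *P g))

monomial : ℤ → ℕ → Poly
monomial c n = replicate n (+ 0) ++ (c ∷ [])

sumP : List Poly → Poly
sumP = foldr _+P_ []

_≡[mod_]_ : Poly → ℕ → Poly → Set
f ≡[mod p ] g = ∀ n → (+ p) ℤD.∣ (coeff f n ℤ.- coeff g n)

hNum : ℕ → Poly
hNum q = (-[1+ 1 ] ∷ + 1 ∷ []) *P (monomial (+ 1) (q ℕ.* q ∸ 1) +P (-[1+ 0 ] ∷ []))

hDen : ℕ → Poly
hDen q = (monomial (+ 1) (q ∸ 1) +P (-[1+ 0 ] ∷ []))
      *P (monomial (+ 1) q +P monomial (-[1+ 0 ]) (q ∸ 1) +P (-[1+ 0 ] ∷ []))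

-- summand for (α, β): included iff 0 < α+β ≤ q-1 (and α,β ≥ 0, β ≤ q-2 by the ranges)
hTerm : ℕ → ℕ → ℕ → Poly
hTerm q α β =
  if (0 <ᵇ α ℕ.+ β) ∧ (α ℕ.+ β ≤ᵇ q ∸ 1)
  then monomial ((+ (2 ^ (α ℕ.+ β) ℕ.* ((2 ℕ.* (q ∸ 1) ∸ α ∸ β) C (q ∸ 1))))
                  ℤ.- (+ ((α ℕ.+ β) C α)))
                ((q ∸ 1) ^ 2 ∸ (α ℕ.+ β ℕ.* q))
  else []

-- right-hand side: t^{(q-1)^2} + Σ_{α ∈ [0,q-1], β ∈ [0,q-2]} hTerm q α β
-- (α ≤ q-1 is forced by α+β ≤ q-1, so the range for α loses nothing)
hRHS : ℕ → Poly
hRHS q = monomial (+ 1) ((q ∸ 1) ^ 2)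
      +P sumP (concatMap (λ α → map (λ β → hTerm q α β) (upTo (q ∸ 1))) (upTo q))

-- Write Q = q - 1, u = t^Q, a = t^q = t·u, V = u^q and b = u + 1, and multiply everything by u.
-- The (α, β) summand of the right-hand side then becomes c(α, β) · a^(Q-α-β) · u^α.  Modulo p,
-- Frobenius gives 2^Q = 1 and (1 + t)^(q+r) = (1 + t^q)(1 + t)^r, whence C(2Q - s, Q) = 0 for
-- s < Q; so on the anti-diagonal α + β = s the coefficient is [s = Q] - C(s, α), and by the
-- binomial theorem the diagonal sums to [s = Q] · Σ_α u^α - a^(Q-s) b^s.  The summation range is
-- the triangle α + β ≤ Q minus its corners (0, 0) and (0, Q), which contribute -a^Q = -V and 0.
-- Hence u · RHS = 2V + G - H with G = Σ_{α ≤ Q} u^α and H = Σ_{s ≤ Q} a^(Q-s) b^s, and the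
-- geometric sums (u - 1) G = V - 1 and (b - a) H = b^q - a^q = V + 1 - aV reduce the claim to a
-- polynomial identity in t, u and V.

module Submission where

open import Defs
open import Level using (0ℓ)
open import Function.Base using (_∘_; id)
open import Data.Nat as ℕ using (ℕ; zero; suc; _∸_; _<_; _≤_; z≤n; s≤s; _!; _<ᵇ_; _≤ᵇ_)
import Data.Nat.Properties as ℕP
open import Data.Nat.Combinatorics using (_C_; nCn≡1; k>n⇒nCk≡0; nCk+nC[k+1]≡[n+1]C[k+1]; nCk≡n!/k![n-k]!; k![n∸k]!∣n!)
open import Data.Nat.Divisibility as ℕD using (_∣_; divides)
open import Data.Nat.DivMod using (_/_; m*n/n≡m)
open import Data.Nat.Primality using (Prime; euclidsLemma; prime⇒nonTrivial; prime⇒nonZero)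
open import Data.Fin using (toℕ)
open import Data.Sum using (inj₁; inj₂)
open import Data.Empty using (⊥-elim)
open import Data.Product using (_,_; proj₂; ∃-syntax)
open import Data.Bool using (Bool; true; false; if_then_else_; _∧_; T)
open import Data.Bool.Properties using (T-∧)
open import Function.Bundles using (Equivalence)
open import Data.List using (List; []; _∷_; map; _++_; concatMap; applyUpTo; upTo)
open import Data.Maybe as Maybe using (Maybe; just; nothing)
open import Data.Integer as ℤ using (ℤ; +_; -[1+_])
import Data.Integer.Properties as ℤP
import Data.Integer.Divisibility.Signed as ℤS
open import Relation.Binary.Structures using (IsEquivalence)
open import Algebra.Bundles using (Semiring; CommutativeSemiring; CommutativeRing)
open import Relation.Nullary using (¬_)
open import Relation.Nullary.Decidable using (dec-true; dec-false)
import Relation.Binary.PropositionalEquality as ≡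
open ≡ using (_≡_; _≢_)

module FiniteSums {c ℓ} (R : Semiring c ℓ) where
  open Semiring R
  open import Relation.Binary.Reasoning.Setoid setoid
  open import Algebra.Properties.CommutativeSemigroup +-commutativeSemigroup using (interchange)

  ∑ : ℕ → (ℕ → Carrier) → Carrier
  ∑ zero    f = 0#
  ∑ (suc n) f = f 0 + ∑ n (f ∘ suc)

  ∑-cong : ∀ n {f g} → (∀ i → i < n → f i ≈ g i) → ∑ n f ≈ ∑ n g
  ∑-cong zero    f≈g = refl
  ∑-cong (suc n) f≈g = +-cong (f≈g 0 (s≤s z≤n)) (∑-cong n (λ i i<n → f≈g (suc i) (s≤s i<n)))

  ∑-zero : ∀ n {f} → (∀ i → i < n → f i ≈ 0#) → ∑ n f ≈ 0#
  ∑-zero zero    f≈0 = refl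
  ∑-zero (suc n) f≈0 =
    trans (+-cong (f≈0 0 (s≤s z≤n)) (∑-zero n (λ i i<n → f≈0 (suc i) (s≤s i<n)))) (+-identityˡ 0#)

  ∑-last : ∀ n f → ∑ (suc n) f ≈ ∑ n f + f n
  ∑-last zero    f = trans (+-identityʳ (f 0)) (sym (+-identityˡ (f 0)))
  ∑-last (suc n) f = begin
    f 0 + ∑ (suc n) (f ∘ suc)         ≈⟨ +-congˡ (∑-last n (f ∘ suc)) ⟩
    f 0 + (∑ n (f ∘ suc) + f (suc n)) ≈⟨ +-assoc (f 0) _ _ ⟨
    ∑ (suc n) f + f (suc n)           ∎

  ∑-+ : ∀ n f g → ∑ n (λ i → f i + g i) ≈ ∑ n f + ∑ n g
  ∑-+ zero    f g = sym (+-identityˡ 0#)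
  ∑-+ (suc n) f g =
    trans (+-congˡ (∑-+ n (f ∘ suc) (g ∘ suc))) (interchange (f 0) (g 0) (∑ n (f ∘ suc)) (∑ n (g ∘ suc)))

  ∑-distribˡ : ∀ n x f → x * ∑ n f ≈ ∑ n (λ i → x * f i)
  ∑-distribˡ zero    x f = zeroʳ x
  ∑-distribˡ (suc n) x f = trans (distribˡ x (f 0) (∑ n (f ∘ suc))) (+-congˡ (∑-distribˡ n x (f ∘ suc)))

  ∑-vanishing-tail : ∀ {M K} f g → K ≤ M → (∀ i → i < K → f i ≈ g i) →
                     (∀ i → K ≤ i → i < M → f i ≈ 0#) → ∑ M f ≈ ∑ K g
  ∑-vanishing-tail {zero} f g z≤n f≈g _ = refl
  ∑-vanishing-tail {suc M} {K} f g K≤M f≈g tail≈0 with ℕP.m≤n⇒m<n∨m≡n K≤M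
  ... | inj₂ ≡.refl = ∑-cong (suc M) f≈g
  ... | inj₁ (s≤s K≤M') = begin
    ∑ (suc M) f  ≈⟨ ∑-last M f ⟩
    ∑ M f + f M  ≈⟨ +-cong (∑-vanishing-tail f g K≤M' f≈g (λ i K≤i i<M → tail≈0 i K≤i (ℕP.m≤n⇒m≤1+n i<M)))
                           (tail≈0 M K≤M' ℕP.≤-refl) ⟩
    ∑ K g + 0#   ≈⟨ +-identityʳ _ ⟩
    ∑ K g        ∎

  ∑-ends : ∀ m f → (∀ i → i < m → f (suc i) ≈ 0#) → ∑ (suc (suc m)) f ≈ f 0 + f (suc m)
  ∑-ends m f inner≈0 = begin
    f 0 + ∑ (suc m) (f ∘ suc)            ≈⟨ +-congˡ (∑-last m (f ∘ suc)) ⟩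
    f 0 + (∑ m (f ∘ suc) + f (suc m))    ≈⟨ +-congˡ (+-congʳ (∑-zero m inner≈0)) ⟩
    f 0 + (0# + f (suc m))               ≈⟨ +-congˡ (+-identityˡ (f (suc m))) ⟩
    f 0 + f (suc m)                      ∎

  ∑-triangle : ∀ n (f : ℕ → ℕ → Carrier) →
               ∑ (suc n) (λ α → ∑ (suc n ∸ α) (f α)) ≈ ∑ (suc n) (λ s → ∑ (suc s) (λ α → f α (s ∸ α)))
  ∑-triangle zero    f = refl
  ∑-triangle (suc n) f = begin
    ∑ (suc (suc n)) rows
      ≈⟨ ∑-last (suc n) rows ⟩
    ∑ (suc n) rows + ∑ (suc (suc n) ∸ suc n) (f (suc n))
      ≈⟨ +-cong split-rows last-row ⟩
    (∑ (suc n) (λ α → ∑ (suc n ∸ α) (f α)) + diagonal) + f (suc n) (n ∸ n)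
      ≈⟨ +-assoc _ diagonal _ ⟩
    ∑ (suc n) (λ α → ∑ (suc n ∸ α) (f α)) + (diagonal + f (suc n) (n ∸ n))
      ≈⟨ +-cong (∑-triangle n f) (sym (∑-last (suc n) (λ α → f α (suc n ∸ α)))) ⟩
    ∑ (suc n) diagonals + diagonals (suc n)
      ≈⟨ ∑-last (suc n) diagonals ⟨
    ∑ (suc (suc n)) diagonals ∎
    where
    rows diagonals : ℕ → Carrier
    rows      α = ∑ (suc (suc n) ∸ α) (f α)
    diagonals s = ∑ (suc s) (λ α → f α (s ∸ α))
    diagonal : Carrier
    diagonal = ∑ (suc n) (λ α → f α (suc n ∸ α))
    split-rows : ∑ (suc n) rows ≈ ∑ (suc n) (λ α → ∑ (suc n ∸ α) (f α)) + diagonal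
    split-rows = trans (∑-cong (suc n) (λ α α<1+n → begin
        ∑ (suc (suc n) ∸ α) (f α)              ≡⟨ ≡.cong (λ m → ∑ m (f α)) (ℕP.+-∸-assoc 1 (ℕP.<⇒≤ α<1+n)) ⟩
        ∑ (suc (suc n ∸ α)) (f α)              ≈⟨ ∑-last (suc n ∸ α) (f α) ⟩
        ∑ (suc n ∸ α) (f α) + f α (suc n ∸ α)  ∎))
      (∑-+ (suc n) (λ α → ∑ (suc n ∸ α) (f α)) (λ α → f α (suc n ∸ α)))
    last-row : ∑ (suc (suc n) ∸ suc n) (f (suc n)) ≈ f (suc n) (n ∸ n)
    last-row rewrite ℕP.m+n∸n≡m 1 n | ℕP.n∸n≡0 n = +-identityʳ (f (suc n) 0)

prime≥2 : ∀ {p} → Prime p → 2 ≤ p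
prime≥2 {p} p-prime = ℕ.nonTrivial⇒n>1 p {{prime⇒nonTrivial p-prime}}

prime∤! : ∀ {p} → Prime p → ∀ m → m < p → ¬ p ∣ m !
prime∤! p-prime zero    _   p∣1 with prime≥2 p-prime | ℕD.∣1⇒≡1 p∣1
... | s≤s () | ≡.refl
prime∤! p-prime (suc m) m<p p∣m! with euclidsLemma (suc m) (m !) p-prime p∣m!
... | inj₁ p∣1+m = ℕP.<⇒≱ m<p (ℕD.∣⇒≤ p∣1+m)
... | inj₂ p∣m!  = prime∤! p-prime m (ℕP.<-trans (ℕP.n<1+n m) m<p) p∣m!

-- p divides p! = (p C k) · k! (p - k)!, but neither k! nor (p - k)!.
prime∣pCk : ∀ {p k} → Prime p → 0 < k → k < p → p ∣ p C k
prime∣pCk {p@(suc m)} {k} p-prime 0<k k<p with k![n∸k]!∣n! {p} {k} (ℕP.<⇒≤ k<p)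
... | divides c p!≡c*d = ≡.subst (p ∣_) (≡.sym pCk≡c) p∣c
  where
  d : ℕ
  d = k ! ℕ.* (p ∸ k) !
  instance
    d≢0 : ℕ.NonZero d
    d≢0 = k ℕP.!* (p ∸ k) !≢0
  pCk≡c : p C k ≡ c
  pCk≡c = ≡.trans (nCk≡n!/k![n-k]! (ℕP.<⇒≤ k<p)) (≡.trans (≡.cong (_/ d) p!≡c*d) (m*n/n≡m c d))
  p∣c : p ∣ c
  p∣c with euclidsLemma c d p-prime (≡.subst (p ∣_) p!≡c*d (ℕD.m∣m*n (m !)))
  ... | inj₁ p∣c = p∣c
  ... | inj₂ p∣d with euclidsLemma (k !) ((p ∸ k) !) p-prime p∣d
  ...   | inj₁ p∣k!     = ⊥-elim (prime∤! p-prime k k<p p∣k!)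
  ...   | inj₂ p∣[p-k]! = ⊥-elim (prime∤! p-prime (p ∸ k) (ℕP.∸-monoʳ-< 0<k (ℕP.<⇒≤ k<p)) p∣[p-k]!)

module BinomialTheorem {c ℓ} (R : CommutativeSemiring c ℓ) where
  open CommutativeSemiring R
  open FiniteSums semiring
  open import Algebra.Properties.Semiring.Mult semiring using (_×_; ×-assocˡ; ×-homo-1)
  open import Algebra.Properties.Semiring.Exp semiring using (_^_; ^-assocʳ; ^-congˡ)
  open import Algebra.Definitions.RawMonoid +-rawMonoid using (sum)
  open import Relation.Binary.Reasoning.Setoid setoid
  import Algebra.Properties.CommutativeSemiring.Binomial R as Binomial

  binomial-∑ : ∀ n x y → (x + y) ^ n ≈ ∑ (suc n) (λ i → (n C i) × (x ^ i * y ^ (n ∸ i)))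
  binomial-∑ n x y = trans (Binomial.theorem n x y) (sum≈∑ (suc n) (λ i → (n C i) × (x ^ i * y ^ (n ∸ i))))
    where
    sum≈∑ : ∀ m (f : ℕ → Carrier) → sum {m} (f ∘ toℕ) ≈ ∑ m f
    sum≈∑ zero    f = refl
    sum≈∑ (suc m) f = +-congˡ (sum≈∑ m (f ∘ suc))

  ^-zeroˡ : ∀ n → 1# ^ n ≈ 1#
  ^-zeroˡ zero    = refl
  ^-zeroˡ (suc n) = trans (*-identityˡ (1# ^ n)) (^-zeroˡ n)

  module _ {p} (p-prime : Prime p) (char-p : ∀ x → p × x ≈ 0#) where

    multiple×≈0 : ∀ {n} x → p ∣ n → n × x ≈ 0#
    multiple×≈0 {n} x (divides c n≡c*p) = begin
      n × x          ≡⟨ ≡.cong (_× x) (≡.trans n≡c*p (ℕP.*-comm c p)) ⟩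
      (p ℕ.* c) × x  ≈⟨ ×-assocˡ x p c ⟨
      p × (c × x)    ≈⟨ char-p (c × x) ⟩
      0#             ∎

    frobenius : ∀ x y → (x + y) ^ p ≈ x ^ p + y ^ p
    frobenius x y with prime≥2 p-prime
    ... | s≤s (s≤s {n = m} _) = begin
      (x + y) ^ p            ≈⟨ binomial-∑ p x y ⟩
      ∑ (suc p) term         ≈⟨ ∑-ends (suc m) term (λ i i<m → multiple×≈0 _ (prime∣pCk p-prime (s≤s z≤n) (s≤s i<m))) ⟩
      term 0 + term p        ≈⟨ +-comm (term 0) (term p) ⟩
      term p + term 0        ≈⟨ +-cong last first ⟩
      x ^ p + y ^ p          ∎
      where
      term : ℕ → Carrier
      term i = (p C i) × (x ^ i * y ^ (p ∸ i))
      first : term 0 ≈ y ^ p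
      first = trans (×-homo-1 _) (*-identityˡ (y ^ p))
      last : term p ≈ x ^ p
      last rewrite nCn≡1 p | ℕP.n∸n≡0 p = trans (×-homo-1 _) (*-identityʳ (x ^ p))

    frobenius-^ : ∀ k x y → (x + y) ^ (p ℕ.^ k) ≈ x ^ (p ℕ.^ k) + y ^ (p ℕ.^ k)
    frobenius-^ zero    x y = distribʳ 1# x y
    frobenius-^ (suc k) x y = begin
      (x + y) ^ (p ℕ.* p ℕ.^ k)                  ≈⟨ ^-assocʳ (x + y) p (p ℕ.^ k) ⟨
      ((x + y) ^ p) ^ (p ℕ.^ k)                  ≈⟨ ^-congˡ (p ℕ.^ k) (frobenius x y) ⟩
      (x ^ p + y ^ p) ^ (p ℕ.^ k)                ≈⟨ frobenius-^ k (x ^ p) (y ^ p) ⟩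
      (x ^ p) ^ (p ℕ.^ k) + (y ^ p) ^ (p ℕ.^ k)  ≈⟨ +-cong (^-assocʳ x p (p ℕ.^ k)) (^-assocʳ y p (p ℕ.^ k)) ⟩
      x ^ (p ℕ.* p ℕ.^ k) + y ^ (p ℕ.* p ℕ.^ k)  ∎

module RingSums {c ℓ} (R : CommutativeRing c ℓ) where
  open CommutativeRing R
  open FiniteSums semiring
  open BinomialTheorem commutativeSemiring using (^-zeroˡ)
  open import Algebra.Properties.Semiring.Exp semiring using (_^_)
  open import Algebra.Properties.Ring ring using ([y-z]x≈yx-zx; -1*x≈-x)
  open import Algebra.Properties.CommutativeSemigroup *-commutativeSemigroup using (x∙yz≈y∙xz)
  open import Relation.Binary.Reasoning.Setoid setoid

  ∑-neg : ∀ n f → ∑ n (λ i → - f i) ≈ - ∑ n f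
  ∑-neg n f = begin
    ∑ n (λ i → - f i)        ≈⟨ ∑-cong n (λ i _ → -1*x≈-x (f i)) ⟨
    ∑ n (λ i → - 1# * f i)   ≈⟨ ∑-distribˡ n (- 1#) f ⟨
    - 1# * ∑ n f             ≈⟨ -1*x≈-x (∑ n f) ⟩
    - ∑ n f                  ∎

  ∑-- : ∀ n f g → ∑ n (λ i → f i - g i) ≈ ∑ n f - ∑ n g
  ∑-- n f g = trans (∑-+ n f (λ i → - g i)) (+-congˡ (∑-neg n g))

  ∑-telescope : ∀ n (f : ℕ → Carrier) → ∑ n (λ i → f (suc i) - f i) ≈ f n - f 0
  ∑-telescope zero    f = sym (-‿inverseʳ (f 0))
  ∑-telescope (suc n) f = begin
    ∑ (suc n) step                     ≈⟨ ∑-last n step ⟩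
    ∑ n step + (f (suc n) - f n)       ≈⟨ +-congʳ (∑-telescope n f) ⟩
    (f n - f 0) + (f (suc n) - f n)    ≈⟨ +-comm _ _ ⟩
    (f (suc n) - f n) + (f n - f 0)    ≈⟨ +-assoc (f (suc n)) (- f n) _ ⟩
    f (suc n) + (- f n + (f n - f 0))  ≈⟨ +-congˡ (+-assoc (- f n) (f n) (- f 0)) ⟨
    f (suc n) + ((- f n + f n) - f 0)  ≈⟨ +-congˡ (trans (+-congʳ (-‿inverseˡ (f n))) (+-identityˡ (- f 0))) ⟩
    f (suc n) - f 0                    ∎
    where
    step : ℕ → Carrier
    step i = f (suc i) - f i

  ∑-geometric : ∀ n A B → (B - A) * ∑ (suc n) (λ s → A ^ (n ∸ s) * B ^ s) ≈ B ^ suc n - A ^ suc n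
  ∑-geometric n A B = begin
    (B - A) * ∑ (suc n) (λ s → A ^ (n ∸ s) * B ^ s)
      ≈⟨ ∑-distribˡ (suc n) (B - A) (λ s → A ^ (n ∸ s) * B ^ s) ⟩
    ∑ (suc n) (λ s → (B - A) * (A ^ (n ∸ s) * B ^ s))
      ≈⟨ ∑-cong (suc n) (λ s s<1+n → term≈step s (ℕP.≤-pred s<1+n)) ⟩
    ∑ (suc n) (λ s → f (suc s) - f s)
      ≈⟨ ∑-telescope (suc n) f ⟩
    f (suc n) - f 0
      ≈⟨ +-congˡ (-‿cong (*-identityʳ (A ^ suc n))) ⟩
    A ^ (n ∸ n) * B ^ suc n - A ^ suc n
      ≡⟨ ≡.cong (λ k → A ^ k * B ^ suc n - A ^ suc n) (ℕP.n∸n≡0 n) ⟩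
    1# * B ^ suc n - A ^ suc n
      ≈⟨ +-congʳ (*-identityˡ (B ^ suc n)) ⟩
    B ^ suc n - A ^ suc n ∎
    where
    f : ℕ → Carrier
    f s = A ^ (suc n ∸ s) * B ^ s
    term≈step : ∀ s → s ≤ n → (B - A) * (A ^ (n ∸ s) * B ^ s) ≈ f (suc s) - f s
    term≈step s s≤n = begin
      (B - A) * (A ^ (n ∸ s) * B ^ s)
        ≈⟨ [y-z]x≈yx-zx _ B A ⟩
      B * (A ^ (n ∸ s) * B ^ s) - A * (A ^ (n ∸ s) * B ^ s)
        ≈⟨ +-cong (x∙yz≈y∙xz B _ _) (-‿cong (sym (*-assoc A _ _))) ⟩
      A ^ (n ∸ s) * (B * B ^ s) - A * A ^ (n ∸ s) * B ^ s
        ≡⟨ ≡.cong (λ k → f (suc s) - A ^ k * B ^ s) (ℕP.+-∸-assoc 1 s≤n) ⟨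
      f (suc s) - f s ∎

  ∑-geometric-1 : ∀ n x → (x - 1#) * ∑ (suc n) (x ^_) ≈ x ^ suc n - 1#
  ∑-geometric-1 n x = begin
    (x - 1#) * ∑ (suc n) (x ^_)                          ≈⟨ *-congˡ (∑-cong (suc n) (λ s _ → powers-of-1 s)) ⟩
    (x - 1#) * ∑ (suc n) (λ s → 1# ^ (n ∸ s) * x ^ s)    ≈⟨ ∑-geometric n 1# x ⟩
    x ^ suc n - 1# ^ suc n                               ≈⟨ +-congˡ (-‿cong (^-zeroˡ (suc n))) ⟩
    x ^ suc n - 1#                                       ∎
    where
    powers-of-1 : ∀ s → x ^ s ≈ 1# ^ (n ∸ s) * x ^ s
    powers-of-1 s = sym (trans (*-congʳ (^-zeroˡ (n ∸ s))) (*-identityˡ (x ^ s)))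

module Congruence (m : ℕ) where
  open import Data.Integer.Tactic.RingSolver using (solve-∀)

  infix 4 _≡ₘ_
  -- A record rather than a bare divisibility, so that both sides can be inferred.
  record _≡ₘ_ (a b : ℤ) : Set where
    constructor mk≡ₘ
    field m∣a-b : + m ℤS.∣ a ℤ.- b
  open _≡ₘ_ public

  private
    m∣-subst : ∀ {x y} → x ≡ y → + m ℤS.∣ x → + m ℤS.∣ y
    m∣-subst = ≡.subst (+ m ℤS.∣_)

  ≡ₘ-reflexive : ∀ {a b} → a ≡ b → a ≡ₘ b
  ≡ₘ-reflexive {a} ≡.refl =
    mk≡ₘ (m∣-subst (≡.sym (ℤP.+-inverseʳ a)) (ℤS.divides (+ 0) (≡.sym (ℤP.*-zeroˡ (+ m)))))

  ≡ₘ-isEquivalence : IsEquivalence _≡ₘ_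
  ≡ₘ-isEquivalence = record
    { refl  = ≡ₘ-reflexive ≡.refl
    ; sym   = λ {a} {b} a≡b → mk≡ₘ (m∣-subst (flip-difference a b) (ℤS.∣m⇒∣-m (m∣a-b a≡b)))
    ; trans = λ {a} {b} {c} a≡b b≡c →
        mk≡ₘ (m∣-subst (chain-difference a b c) (ℤS.∣m∣n⇒∣m+n (m∣a-b a≡b) (m∣a-b b≡c)))
    }
    where
    flip-difference : ∀ a b → ℤ.- (a ℤ.- b) ≡ b ℤ.- a
    flip-difference = solve-∀
    chain-difference : ∀ a b c → (a ℤ.- b) ℤ.+ (b ℤ.- c) ≡ a ℤ.- c
    chain-difference = solve-∀

  open IsEquivalence ≡ₘ-isEquivalence public
    using () renaming (refl to ≡ₘ-refl; sym to ≡ₘ-sym; trans to ≡ₘ-trans)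

  ≡ₘ-resp-≡ : ∀ {a b c d} → a ≡ b → c ≡ d → a ≡ₘ c → b ≡ₘ d
  ≡ₘ-resp-≡ ≡.refl ≡.refl a≡c = a≡c

  +-cong-≡ₘ : ∀ {a b c d} → a ≡ₘ b → c ≡ₘ d → a ℤ.+ c ≡ₘ b ℤ.+ d
  +-cong-≡ₘ {a} {b} {c} {d} a≡b c≡d =
    mk≡ₘ (m∣-subst (differences a b c d) (ℤS.∣m∣n⇒∣m+n (m∣a-b a≡b) (m∣a-b c≡d)))
    where
    differences : ∀ a b c d → (a ℤ.- b) ℤ.+ (c ℤ.- d) ≡ (a ℤ.+ c) ℤ.- (b ℤ.+ d)
    differences = solve-∀

  *-cong-≡ₘ : ∀ {a b c d} → a ≡ₘ b → c ≡ₘ d → a ℤ.* c ≡ₘ b ℤ.* d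
  *-cong-≡ₘ {a} {b} {c} {d} a≡b c≡d =
    mk≡ₘ (m∣-subst (differences a b c d) (ℤS.∣m∣n⇒∣m+n (ℤS.∣n⇒∣m*n a (m∣a-b c≡d)) (ℤS.∣m⇒∣m*n d (m∣a-b a≡b))))
    where
    differences : ∀ a b c d → a ℤ.* (c ℤ.- d) ℤ.+ (a ℤ.- b) ℤ.* d ≡ a ℤ.* c ℤ.- b ℤ.* d
    differences = solve-∀

  neg-cong-≡ₘ : ∀ {a b} → a ≡ₘ b → ℤ.- a ≡ₘ ℤ.- b
  neg-cong-≡ₘ {a} {b} a≡b = mk≡ₘ (m∣-subst (differences a b) (ℤS.∣m⇒∣-m (m∣a-b a≡b)))
    where
    differences : ∀ a b → ℤ.- (a ℤ.- b) ≡ ℤ.- a ℤ.- ℤ.- b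
    differences = solve-∀

  m*x≡ₘ0 : ∀ x → + m ℤ.* x ≡ₘ + 0
  m*x≡ₘ0 x = mk≡ₘ (m∣-subst (≡.sym (ℤP.+-identityʳ _)) (ℤS.∣m⇒∣m*n x ℤS.∣-refl))

  *-cancelˡ-≡ₘ : Prime m → ∀ {c a b} → ¬ m ∣ c → + c ℤ.* a ≡ₘ + c ℤ.* b → a ≡ₘ b
  *-cancelˡ-≡ₘ m-prime {c} {a} {b} m∤c ca≡cb
    with euclidsLemma c ℤ.∣ a ℤ.- b ∣ m-prime m∣c*∣a-b∣
    where
    factor : ∀ x a b → x ℤ.* a ℤ.- x ℤ.* b ≡ x ℤ.* (a ℤ.- b)
    factor = solve-∀
    m∣c*∣a-b∣ : m ∣ c ℕ.* ℤ.∣ a ℤ.- b ∣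
    m∣c*∣a-b∣ = ≡.subst (m ∣_) (ℤP.abs-* (+ c) (a ℤ.- b)) (ℤS.∣⇒∣ᵤ (m∣-subst (factor (+ c) a b) (m∣a-b ca≡cb)))
  ... | inj₁ m∣c     = ⊥-elim (m∤c m∣c)
  ... | inj₂ m∣∣a-b∣ = mk≡ₘ (ℤS.∣ᵤ⇒∣ m∣∣a-b∣)

module ℤ∑ = FiniteSums ℤP.+-*-semiring

infix 4 _≐_
record _≐_ (f g : Poly) : Set where
  constructor mk≐
  field coeff-≡ : ∀ n → coeff f n ≡ coeff g n
open _≐_ public

≐-refl : ∀ {f} → f ≐ f
≐-refl = mk≐ λ _ → ≡.refl

≐-sym : ∀ {f g} → f ≐ g → g ≐ f
≐-sym f≐g = mk≐ λ n → ≡.sym (coeff-≡ f≐g n)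

≐-trans : ∀ {f g h} → f ≐ g → g ≐ h → f ≐ h
≐-trans f≐g g≐h = mk≐ λ n → ≡.trans (coeff-≡ f≐g n) (coeff-≡ g≐h n)

∷-cong : ∀ {a b f g} → a ≡ b → f ≐ g → a ∷ f ≐ b ∷ g
∷-cong a≡b f≐g = mk≐ λ { zero → a≡b ; (suc n) → coeff-≡ f≐g n }

negP : Poly → Poly
negP = map (λ a → ℤ.- a)

coeff-+P : ∀ f g n → coeff (f +P g) n ≡ coeff f n ℤ.+ coeff g n
coeff-+P []      g       n       = ≡.sym (ℤP.+-identityˡ (coeff g n))
coeff-+P (a ∷ f) []      n       = ≡.sym (ℤP.+-identityʳ (coeff (a ∷ f) n))
coeff-+P (a ∷ f) (b ∷ g) zero    = ≡.refl
coeff-+P (a ∷ f) (b ∷ g) (suc n) = coeff-+P f g n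

coeff-scale : ∀ a g n → coeff (map (a ℤ.*_) g) n ≡ a ℤ.* coeff g n
coeff-scale a []      n       = ≡.sym (ℤP.*-zeroʳ a)
coeff-scale a (b ∷ g) zero    = ≡.refl
coeff-scale a (b ∷ g) (suc n) = coeff-scale a g n

coeff-negP : ∀ g n → coeff (negP g) n ≡ ℤ.- coeff g n
coeff-negP []      n       = ≡.refl
coeff-negP (b ∷ g) zero    = ≡.refl
coeff-negP (b ∷ g) (suc n) = coeff-negP g n

convolution : Poly → Poly → ℕ → ℤ
convolution f g n = ℤ∑.∑ (suc n) (λ i → coeff f i ℤ.* coeff g (n ∸ i))

coeff-*P : ∀ f g n → coeff (f *P g) n ≡ convolution f g n
coeff-*P []      g n       = ≡.sym (ℤ∑.∑-zero (suc n) (λ i _ → ℤP.*-zeroˡ (coeff g (n ∸ i))))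
coeff-*P (a ∷ f) g zero    =
  ≡.trans (coeff-+P (map (a ℤ.*_) g) (+ 0 ∷ f *P g) 0) (≡.cong (ℤ._+ + 0) (coeff-scale a g 0))
coeff-*P (a ∷ f) g (suc n) =
  ≡.trans (coeff-+P (map (a ℤ.*_) g) (+ 0 ∷ f *P g) (suc n)) (≡.cong₂ ℤ._+_ (coeff-scale a g (suc n)) (coeff-*P f g n))

+P-cong : ∀ {f f′ g g′} → f ≐ f′ → g ≐ g′ → f +P g ≐ f′ +P g′
+P-cong {f} {f′} {g} {g′} f≐f′ g≐g′ = mk≐ λ n → begin
  coeff (f +P g) n            ≡⟨ coeff-+P f g n ⟩
  coeff f n ℤ.+ coeff g n     ≡⟨ ≡.cong₂ ℤ._+_ (coeff-≡ f≐f′ n) (coeff-≡ g≐g′ n) ⟩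
  coeff f′ n ℤ.+ coeff g′ n   ≡⟨ coeff-+P f′ g′ n ⟨
  coeff (f′ +P g′) n          ∎
  where open ≡.≡-Reasoning

+P-comm : ∀ f g → f +P g ≐ g +P f
+P-comm f g = mk≐ λ n →
  ≡.trans (coeff-+P f g n) (≡.trans (ℤP.+-comm (coeff f n) (coeff g n)) (≡.sym (coeff-+P g f n)))

+P-assoc : ∀ f g h → (f +P g) +P h ≐ f +P (g +P h)
+P-assoc f g h = mk≐ λ n → begin
  coeff ((f +P g) +P h) n                      ≡⟨ coeff-+P (f +P g) h n ⟩
  coeff (f +P g) n ℤ.+ coeff h n               ≡⟨ ≡.cong (ℤ._+ coeff h n) (coeff-+P f g n) ⟩
  coeff f n ℤ.+ coeff g n ℤ.+ coeff h n        ≡⟨ ℤP.+-assoc (coeff f n) (coeff g n) (coeff h n) ⟩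
  coeff f n ℤ.+ (coeff g n ℤ.+ coeff h n)      ≡⟨ ≡.cong (λ z → coeff f n ℤ.+ z) (coeff-+P g h n) ⟨
  coeff f n ℤ.+ coeff (g +P h) n               ≡⟨ coeff-+P f (g +P h) n ⟨
  coeff (f +P (g +P h)) n                      ∎
  where open ≡.≡-Reasoning

+P-identityʳ : ∀ f → f +P [] ≐ f
+P-identityʳ f = mk≐ λ n → ≡.trans (coeff-+P f [] n) (ℤP.+-identityʳ (coeff f n))

+P-inverseˡ : ∀ f → negP f +P f ≐ []
+P-inverseˡ f = mk≐ λ n →
  ≡.trans (coeff-+P (negP f) f n) (≡.trans (≡.cong (ℤ._+ coeff f n) (coeff-negP f n)) (ℤP.+-inverseˡ (coeff f n)))

+P-inverseʳ : ∀ f → f +P negP f ≐ []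
+P-inverseʳ f = ≐-trans (+P-comm f (negP f)) (+P-inverseˡ f)

*P-distribˡ : ∀ f g h → f *P (g +P h) ≐ f *P g +P f *P h
*P-distribˡ f g h = mk≐ coeff-distrib
  where
  open ≡.≡-Reasoning
  coeff-distrib : ∀ n → coeff (f *P (g +P h)) n ≡ coeff (f *P g +P f *P h) n
  coeff-distrib n = begin
    coeff (f *P (g +P h)) n                           ≡⟨ coeff-*P f (g +P h) n ⟩
    convolution f (g +P h) n                          ≡⟨ ℤ∑.∑-cong (suc n) (λ i _ → distrib i) ⟩
    ℤ∑.∑ (suc n) (λ i → F i ℤ.+ G i)                  ≡⟨ ℤ∑.∑-+ (suc n) F G ⟩
    convolution f g n ℤ.+ convolution f h n           ≡⟨ ≡.cong₂ ℤ._+_ (coeff-*P f g n) (coeff-*P f h n) ⟨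
    coeff (f *P g) n ℤ.+ coeff (f *P h) n             ≡⟨ coeff-+P (f *P g) (f *P h) n ⟨
    coeff (f *P g +P f *P h) n                        ∎
    where
    F G : ℕ → ℤ
    F i = coeff f i ℤ.* coeff g (n ∸ i)
    G i = coeff f i ℤ.* coeff h (n ∸ i)
    distrib : ∀ i → coeff f i ℤ.* coeff (g +P h) (n ∸ i) ≡ F i ℤ.+ G i
    distrib i = ≡.trans (≡.cong (coeff f i ℤ.*_) (coeff-+P g h (n ∸ i)))
                        (ℤP.*-distribˡ-+ (coeff f i) (coeff g (n ∸ i)) (coeff h (n ∸ i)))

*P-zeroʳ : ∀ f → f *P [] ≐ []
*P-zeroʳ []      = ≐-refl
*P-zeroʳ (a ∷ f) = mk≐ λ { zero → ≡.refl ; (suc n) → coeff-≡ (*P-zeroʳ f) n }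

+P-left-comm : ∀ f g h → f +P (g +P h) ≐ g +P (f +P h)
+P-left-comm f g h =
  ≐-trans (≐-sym (+P-assoc f g h)) (≐-trans (+P-cong (+P-comm f g) ≐-refl) (+P-assoc g f h))

*P-∷ʳ : ∀ f b g → f *P (b ∷ g) ≐ map (b ℤ.*_) f +P (+ 0 ∷ f *P g)
*P-∷ʳ []      b g = mk≐ λ { zero → ≡.refl ; (suc n) → ≡.refl }
*P-∷ʳ (a ∷ f) b g = ∷-cong (≡.cong (ℤ._+ + 0) (ℤP.*-comm a b))
  (≐-trans (+P-cong ≐-refl (*P-∷ʳ f b g)) (+P-left-comm (map (a ℤ.*_) g) (map (b ℤ.*_) f) (+ 0 ∷ f *P g)))

*P-comm : ∀ f g → f *P g ≐ g *P f
*P-comm []      g = ≐-sym (*P-zeroʳ g)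
*P-comm (a ∷ f) g = ≐-trans (+P-cong ≐-refl (∷-cong ≡.refl (*P-comm f g))) (≐-sym (*P-∷ʳ g a f))

*P-distribʳ : ∀ f g h → (g +P h) *P f ≐ g *P f +P h *P f
*P-distribʳ f g h = ≐-trans (*P-comm (g +P h) f)
  (≐-trans (*P-distribˡ f g h) (+P-cong (*P-comm f g) (*P-comm f h)))

*P-scaleˡ : ∀ a g h → map (a ℤ.*_) g *P h ≐ map (a ℤ.*_) (g *P h)
*P-scaleˡ a g h = mk≐ coeff-scaled
  where
  open ≡.≡-Reasoning
  coeff-scaled : ∀ n → coeff (map (a ℤ.*_) g *P h) n ≡ coeff (map (a ℤ.*_) (g *P h)) n
  coeff-scaled n = begin
    coeff (map (a ℤ.*_) g *P h) n
      ≡⟨ coeff-*P (map (a ℤ.*_) g) h n ⟩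
    convolution (map (a ℤ.*_) g) h n
      ≡⟨ ℤ∑.∑-cong (suc n) (λ i _ → reassociate i) ⟩
    ℤ∑.∑ (suc n) (λ i → a ℤ.* (coeff g i ℤ.* coeff h (n ∸ i)))
      ≡⟨ ℤ∑.∑-distribˡ (suc n) a (λ i → coeff g i ℤ.* coeff h (n ∸ i)) ⟨
    a ℤ.* convolution g h n
      ≡⟨ ≡.cong (a ℤ.*_) (coeff-*P g h n) ⟨
    a ℤ.* coeff (g *P h) n
      ≡⟨ coeff-scale a (g *P h) n ⟨
    coeff (map (a ℤ.*_) (g *P h)) n ∎
    where
    reassociate : ∀ i → coeff (map (a ℤ.*_) g) i ℤ.* coeff h (n ∸ i) ≡ a ℤ.* (coeff g i ℤ.* coeff h (n ∸ i))
    reassociate i = ≡.trans (≡.cong (ℤ._* coeff h (n ∸ i)) (coeff-scale a g i)) (ℤP.*-assoc a (coeff g i) _)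

*P-shiftˡ : ∀ f h → (+ 0 ∷ f) *P h ≐ + 0 ∷ f *P h
*P-shiftˡ f h = mk≐ λ n → ≡.trans (coeff-+P (map (+ 0 ℤ.*_) h) (+ 0 ∷ f *P h) n)
  (≡.trans (≡.cong (ℤ._+ coeff (+ 0 ∷ f *P h) n) (≡.trans (coeff-scale (+ 0) h n) (ℤP.*-zeroˡ (coeff h n))))
           (ℤP.+-identityˡ _))

*P-assoc : ∀ f g h → (f *P g) *P h ≐ f *P (g *P h)
*P-assoc []      g h = ≐-refl
*P-assoc (a ∷ f) g h = ≐-trans (*P-distribʳ h (map (a ℤ.*_) g) (+ 0 ∷ f *P g))
  (+P-cong (*P-scaleˡ a g h) (≐-trans (*P-shiftˡ (f *P g) h) (∷-cong ≡.refl (*P-assoc f g h))))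

+P-0∷[] : ∀ f → f +P (+ 0 ∷ []) ≐ f
+P-0∷[] f = mk≐ λ n → ≡.trans (coeff-+P f (+ 0 ∷ []) n)
  (≡.trans (≡.cong (λ z → coeff f n ℤ.+ z) (coeff-0∷[] n)) (ℤP.+-identityʳ (coeff f n)))
  where
  coeff-0∷[] : ∀ n → coeff (+ 0 ∷ []) n ≡ + 0
  coeff-0∷[] zero    = ≡.refl
  coeff-0∷[] (suc n) = ≡.refl

*P-identityˡ : ∀ g → (+ 1 ∷ []) *P g ≐ g
*P-identityˡ g =
  ≐-trans (+P-0∷[] (map (+ 1 ℤ.*_) g)) (mk≐ λ n → ≡.trans (coeff-scale (+ 1) g n) (ℤP.*-identityˡ (coeff g n)))

*P-identityʳ : ∀ g → g *P (+ 1 ∷ []) ≐ g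
*P-identityʳ g = ≐-trans (*P-comm g (+ 1 ∷ [])) (*P-identityˡ g)

module PolynomialsModulo (m : ℕ) where
  open Congruence m

  infix 4 _≋_
  record _≋_ (f g : Poly) : Set where
    constructor mk≋
    field coeff-≡ₘ : ∀ n → coeff f n ≡ₘ coeff g n
  open _≋_ public

  ≐⇒≋ : ∀ {f g} → f ≐ g → f ≋ g
  ≐⇒≋ f≐g = mk≋ λ n → ≡ₘ-reflexive (coeff-≡ f≐g n)

  ≋-isEquivalence : IsEquivalence _≋_
  ≋-isEquivalence = record
    { refl  = mk≋ λ _ → ≡ₘ-refl
    ; sym   = λ f≋g → mk≋ λ n → ≡ₘ-sym (coeff-≡ₘ f≋g n)
    ; trans = λ f≋g g≋h → mk≋ λ n → ≡ₘ-trans (coeff-≡ₘ f≋g n) (coeff-≡ₘ g≋h n)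
    }

  private
    ∑-cong-≡ₘ : ∀ n {F G} → (∀ i → F i ≡ₘ G i) → ℤ∑.∑ n F ≡ₘ ℤ∑.∑ n G
    ∑-cong-≡ₘ zero    F≡G = ≡ₘ-refl
    ∑-cong-≡ₘ (suc n) F≡G = +-cong-≡ₘ (F≡G 0) (∑-cong-≡ₘ n (F≡G ∘ suc))

  +P-cong-≋ : ∀ {f f′ g g′} → f ≋ f′ → g ≋ g′ → f +P g ≋ f′ +P g′
  +P-cong-≋ {f} {f′} {g} {g′} f≋f′ g≋g′ = mk≋ λ n →
    ≡ₘ-resp-≡ (≡.sym (coeff-+P f g n)) (≡.sym (coeff-+P f′ g′ n))
      (+-cong-≡ₘ (coeff-≡ₘ f≋f′ n) (coeff-≡ₘ g≋g′ n))

  *P-cong-≋ : ∀ {f f′ g g′} → f ≋ f′ → g ≋ g′ → f *P g ≋ f′ *P g′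
  *P-cong-≋ {f} {f′} {g} {g′} f≋f′ g≋g′ = mk≋ λ n →
    ≡ₘ-resp-≡ (≡.sym (coeff-*P f g n)) (≡.sym (coeff-*P f′ g′ n))
      (∑-cong-≡ₘ (suc n) (λ i → *-cong-≡ₘ (coeff-≡ₘ f≋f′ i) (coeff-≡ₘ g≋g′ (n ∸ i))))

  negP-cong-≋ : ∀ {f g} → f ≋ g → negP f ≋ negP g
  negP-cong-≋ {f} {g} f≋g = mk≋ λ n →
    ≡ₘ-resp-≡ (≡.sym (coeff-negP f n)) (≡.sym (coeff-negP g n)) (neg-cong-≡ₘ (coeff-≡ₘ f≋g n))

  polynomialRing : CommutativeRing 0ℓ 0ℓ
  polynomialRing = record
    { Carrier = Poly ; _≈_ = _≋_ ; _+_ = _+P_ ; _*_ = _*P_ ; -_ = negP ; 0# = [] ; 1# = + 1 ∷ []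
    ; isCommutativeRing = record
      { isRing = record
        { +-isAbelianGroup = record
          { isGroup = record
            { isMonoid = record
              { isSemigroup = record
                { isMagma = record { isEquivalence = ≋-isEquivalence ; ∙-cong = +P-cong-≋ }
                ; assoc = λ f g h → ≐⇒≋ (+P-assoc f g h) }
              ; identity = (λ f → ≐⇒≋ (≐-refl {f})) , (λ f → ≐⇒≋ (+P-identityʳ f)) }
            ; inverse = (λ f → ≐⇒≋ (+P-inverseˡ f)) , (λ f → ≐⇒≋ (+P-inverseʳ f))
            ; ⁻¹-cong = negP-cong-≋ }
          ; comm = λ f g → ≐⇒≋ (+P-comm f g) }
        ; *-cong = *P-cong-≋
        ; *-assoc = λ f g h → ≐⇒≋ (*P-assoc f g h)
        ; *-identity = (λ f → ≐⇒≋ (*P-identityˡ f)) , (λ f → ≐⇒≋ (*P-identityʳ f))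
        ; distrib = (λ f g h → ≐⇒≋ (*P-distribˡ f g h)) , (λ f g h → ≐⇒≋ (*P-distribʳ f g h)) }
      ; *-comm = λ f g → ≐⇒≋ (*P-comm f g) } }

  open CommutativeRing polynomialRing hiding (zero)
  open import Algebra.Properties.Semiring.Exp semiring using (_^_)
  open import Algebra.Properties.Semiring.Mult semiring using (_×_)

  X : Poly
  X = + 0 ∷ + 1 ∷ []

  X*P≐shift : ∀ F → X *P F ≐ + 0 ∷ F
  X*P≐shift F = ≐-trans (*P-shiftˡ (+ 1 ∷ []) F) (∷-cong ≡.refl (*P-identityˡ F))

  X^≐monomial : ∀ e → X ^ e ≐ monomial (+ 1) e
  X^≐monomial zero    = ≐-refl
  X^≐monomial (suc e) = ≐-trans (X*P≐shift (X ^ e)) (∷-cong ≡.refl (X^≐monomial e))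

  constant : ℤ → Poly
  constant c = c ∷ []

  monomial≈ : ∀ c e → monomial c e ≈ constant c * X ^ e
  monomial≈ c e = ≐⇒≋ (mk≐ λ n → begin
    coeff (monomial c e) n               ≡⟨ coeff-monomial e n ⟩
    c ℤ.* coeff (monomial (+ 1) e) n     ≡⟨ ≡.cong (c ℤ.*_) (coeff-≡ (X^≐monomial e) n) ⟨
    c ℤ.* coeff (X ^ e) n                ≡⟨ coeff-scale c (X ^ e) n ⟨
    coeff (map (c ℤ.*_) (X ^ e)) n       ≡⟨ coeff-≡ (+P-0∷[] (map (c ℤ.*_) (X ^ e))) n ⟨
    coeff (constant c * X ^ e) n         ∎)
    where
    open ≡.≡-Reasoning
    coeff-monomial : ∀ e n → coeff (monomial c e) n ≡ c ℤ.* coeff (monomial (+ 1) e) n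
    coeff-monomial zero    zero    = ≡.sym (ℤP.*-identityʳ c)
    coeff-monomial zero    (suc n) = ≡.sym (ℤP.*-zeroʳ c)
    coeff-monomial (suc e) zero    = ≡.sym (ℤP.*-zeroʳ c)
    coeff-monomial (suc e) (suc n) = coeff-monomial e n

  coeff-× : ∀ n F i → coeff (n × F) i ≡ + n ℤ.* coeff F i
  coeff-× zero    F i = ≡.sym (ℤP.*-zeroˡ (coeff F i))
  coeff-× (suc n) F i = ≡.trans (coeff-+P F (n × F) i)
    (≡.trans (≡.cong (λ z → coeff F i ℤ.+ z) (coeff-× n F i)) (≡.sym (ℤP.suc-* (+ n) (coeff F i))))

  char-m : ∀ F → m × F ≈ 0#
  char-m F = mk≋ λ i → ≡ₘ-resp-≡ (≡.sym (coeff-× m F i)) ≡.refl (m*x≡ₘ0 (coeff F i))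

  X^[1+k]*P≐shift : ∀ k F → X ^ suc k * F ≐ + 0 ∷ X ^ k * F
  X^[1+k]*P≐shift k F = ≐-trans (*P-assoc X (X ^ k) F) (X*P≐shift (X ^ k * F))

  coeff-X^*-+ : ∀ k F n → coeff (X ^ k * F) (k ℕ.+ n) ≡ coeff F n
  coeff-X^*-+ zero    F n = coeff-≡ (*P-identityˡ F) n
  coeff-X^*-+ (suc k) F n =
    ≡.trans (coeff-≡ (X^[1+k]*P≐shift k F) (suc (k ℕ.+ n))) (coeff-X^*-+ k F n)

  coeff-X^*-< : ∀ k F n → n < k → coeff (X ^ k * F) n ≡ + 0
  coeff-X^*-< (suc k) F zero    _         = coeff-≡ (X^[1+k]*P≐shift k F) 0
  coeff-X^*-< (suc k) F (suc n) (s≤s n<k) =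
    ≡.trans (coeff-≡ (X^[1+k]*P≐shift k F) (suc n)) (coeff-X^*-< k F n n<k)

  X^*-cancelˡ : ∀ k {F G} → X ^ k * F ≈ X ^ k * G → F ≈ G
  X^*-cancelˡ k {F} {G} X^kF≈X^kG =
    mk≋ λ n → ≡ₘ-resp-≡ (coeff-X^*-+ k F n) (coeff-X^*-+ k G n) (coeff-≡ₘ X^kF≈X^kG (k ℕ.+ n))

  coeff-[1+X]^ : ∀ n j → coeff ((1# + X) ^ n) j ≡ + (n C j)
  coeff-[1+X]^ zero    zero    = ≡.refl
  coeff-[1+X]^ zero    (suc j) = ≡.refl
  coeff-[1+X]^ (suc n) j = ≡.trans (coeff-≡ [1+X]*F≐ j) (≡.trans (coeff-+P F (+ 0 ∷ F) j) (pascal j))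
    where
    F : Poly
    F = (1# + X) ^ n
    [1+X]*F≐ : (1# + X) * F ≐ F +P (+ 0 ∷ F)
    [1+X]*F≐ = ≐-trans (*P-distribʳ F (+ 1 ∷ []) X) (+P-cong (*P-identityˡ F) (X*P≐shift F))
    pascal : ∀ j → coeff F j ℤ.+ coeff (+ 0 ∷ F) j ≡ + (suc n C j)
    pascal zero    = ≡.trans (ℤP.+-identityʳ _) (coeff-[1+X]^ n 0)
    pascal (suc j) = ≡.trans (≡.cong₂ ℤ._+_ (coeff-[1+X]^ n (suc j)) (coeff-[1+X]^ n j))
      (≡.cong +_ (≡.trans (ℕP.+-comm (n C suc j) (n C j)) (nCk+nC[k+1]≡[n+1]C[k+1] n j)))

  open FiniteSums semiring using (∑)

  sumP-map-applyUpTo : ∀ n (f : ℕ → ℕ) (g : ℕ → Poly) → sumP (map g (applyUpTo f n)) ≡ ∑ n (g ∘ f)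
  sumP-map-applyUpTo zero    f g = ≡.refl
  sumP-map-applyUpTo (suc n) f g = ≡.cong (g (f 0) +P_) (sumP-map-applyUpTo n (f ∘ suc) g)

  sumP-++ : ∀ Fs Gs → sumP (Fs ++ Gs) ≈ sumP Fs + sumP Gs
  sumP-++ []       Gs = sym (+-identityˡ (sumP Gs))
  sumP-++ (F ∷ Fs) Gs = trans (+-congˡ (sumP-++ Fs Gs)) (sym (+-assoc F (sumP Fs) (sumP Gs)))

  sumP-concatMap-applyUpTo : ∀ n (f : ℕ → ℕ) (Fs : ℕ → List Poly) →
                             sumP (concatMap Fs (applyUpTo f n)) ≈ ∑ n (sumP ∘ Fs ∘ f)
  sumP-concatMap-applyUpTo zero    f Fs = refl
  sumP-concatMap-applyUpTo (suc n) f Fs =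
    trans (sumP-++ (Fs (f 0)) _) (+-congˡ (sumP-concatMap-applyUpTo n (f ∘ suc) Fs))

  constant-cong : ∀ {c d} → c ≡ₘ d → constant c ≈ constant d
  constant-cong c≡d = mk≋ λ { zero → c≡d ; (suc n) → ≡ₘ-refl }

  constant≈× : ∀ n → constant (+ n) ≈ n × 1#
  constant≈× n = mk≋ λ i → ≡ₘ-reflexive (≡.sym (≡.trans (coeff-× n 1# i) (lemma i)))
    where
    lemma : ∀ i → + n ℤ.* coeff 1# i ≡ coeff (constant (+ n)) i
    lemma zero    = ℤP.*-identityʳ (+ n)
    lemma (suc i) = ℤP.*-zeroʳ (+ n)

  -- Lets the ring solver cancel coefficients, which it can only do after recognising them as zero.
  is-zero? : ∀ F → Maybe (0# ≈ F)
  is-zero? F = Maybe.map (λ F≡0 → mk≋ λ n → ≡ₘ-reflexive (≡.sym (F≡0 n))) (all-zero? F)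
    where
    all-zero? : ∀ F → Maybe (∀ n → coeff F n ≡ + 0)
    all-zero? []              = just λ _ → ≡.refl
    all-zero? (+ zero  ∷ F)   = Maybe.map (λ F≡0 → λ { zero → ≡.refl ; (suc n) → F≡0 n }) (all-zero? F)
    all-zero? (+ suc _ ∷ _)   = nothing
    all-zero? (-[1+ _ ] ∷ _)  = nothing

module PrimePowerCongruences {p} (p-prime : Prime p) where
  open Congruence p
  open PolynomialsModulo p
  open CommutativeRing polynomialRing hiding (zero)
  open BinomialTheorem commutativeSemiring using (^-zeroˡ; frobenius-^)
  open import Algebra.Properties.Semiring.Exp semiring using (_^_; ^-homo-*)
  open import Relation.Binary.Reasoning.Setoid setoid

  coeff₀-[1+1]^ : ∀ n → coeff ((1# + 1#) ^ n) 0 ≡ + (2 ℕ.^ n)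
  coeff₀-[1+1]^ zero    = ≡.refl
  coeff₀-[1+1]^ (suc n) = ≡.trans (coeff-≡ (+P-0∷[] (map (+ 2 ℤ.*_) ((1# + 1#) ^ n))) 0)
    (≡.trans (coeff-scale (+ 2) ((1# + 1#) ^ n) 0)
             (≡.trans (≡.cong (+ 2 ℤ.*_) (coeff₀-[1+1]^ n)) (≡.sym (ℤP.pos-* 2 (2 ℕ.^ n)))))

  2^[p^k]≡2 : ∀ k → + (2 ℕ.^ (p ℕ.^ k)) ≡ₘ + 2
  2^[p^k]≡2 k = ≡ₘ-resp-≡ (coeff₀-[1+1]^ (p ℕ.^ k)) ≡.refl (coeff-≡ₘ [1+1]^q≈2 0)
    where
    [1+1]^q≈2 : (1# + 1#) ^ (p ℕ.^ k) ≈ 1# + 1#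
    [1+1]^q≈2 = trans (frobenius-^ p-prime char-m k 1# 1#) (+-cong (^-zeroˡ (p ℕ.^ k)) (^-zeroˡ (p ℕ.^ k)))

  2^[p^k-1]≡1 : p ≢ 2 → ∀ k {Q} → p ℕ.^ k ≡ suc Q → + (2 ℕ.^ Q) ≡ₘ + 1
  2^[p^k-1]≡1 p≢2 k {Q} p^k≡1+Q = *-cancelˡ-≡ₘ p-prime p∤2 (≡ₘ-resp-≡ 2^[1+Q]≡2*2^Q ≡.refl 2^[1+Q]≡2)
    where
    p∤2 : ¬ p ∣ 2
    p∤2 p∣2 = p≢2 (ℕP.≤-antisym (ℕD.∣⇒≤ p∣2) (prime≥2 p-prime))
    2^[1+Q]≡2 : + (2 ℕ.^ suc Q) ≡ₘ + 2
    2^[1+Q]≡2 = ≡.subst (λ n → + (2 ℕ.^ n) ≡ₘ + 2) p^k≡1+Q (2^[p^k]≡2 k)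
    2^[1+Q]≡2*2^Q : + (2 ℕ.^ suc Q) ≡ + 2 ℤ.* + (2 ℕ.^ Q)
    2^[1+Q]≡2*2^Q = ℤP.pos-* 2 (2 ℕ.^ Q)

  -- The first step of Lucas' theorem: (1 + X)^(q + r) = (1 + X^q) (1 + X)^r for q a power of p.
  [p^k+r]Cj≡rCj : ∀ k r j → j < p ℕ.^ k → + ((p ℕ.^ k ℕ.+ r) C j) ≡ₘ + (r C j)
  [p^k+r]Cj≡rCj k r j j<q = ≡ₘ-resp-≡ (coeff-[1+X]^ (q ℕ.+ r) j) coeff-expanded (coeff-≡ₘ expand j)
    where
    q : ℕ
    q = p ℕ.^ k
    F : Poly
    F = (1# + X) ^ r
    expand : (1# + X) ^ (q ℕ.+ r) ≈ F + X ^ q * F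
    expand = begin
      (1# + X) ^ (q ℕ.+ r)       ≈⟨ ^-homo-* (1# + X) q r ⟩
      (1# + X) ^ q * F           ≈⟨ *-congʳ (frobenius-^ p-prime char-m k 1# X) ⟩
      (1# ^ q + X ^ q) * F       ≈⟨ *-congʳ (+-congʳ (^-zeroˡ q)) ⟩
      (1# + X ^ q) * F           ≈⟨ distribʳ F 1# (X ^ q) ⟩
      1# * F + X ^ q * F         ≈⟨ +-congʳ (*-identityˡ F) ⟩
      F + X ^ q * F              ∎
    coeff-expanded : coeff (F + X ^ q * F) j ≡ + (r C j)
    coeff-expanded = ≡.trans (coeff-+P F (X ^ q * F) j)
      (≡.trans (≡.cong₂ ℤ._+_ (coeff-[1+X]^ r j) (coeff-X^*-< q F j j<q)) (ℤP.+-identityʳ _))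

module IndexArithmetic where
  open import Data.Nat using (_+_; _*_; _^_)
  open import Data.Nat.Tactic.RingSolver using (solve-∀)
  open ℕP.≤-Reasoning

  Q²≡Q*Q : ∀ Q → Q ^ 2 ≡ Q * Q
  Q²≡Q*Q Q = ≡.cong (Q *_) (ℕP.*-identityʳ Q)

  -- The exponent of t in u · t^((q-1)² - (α + βq)) when q = suc Q.
  exponent-identity : ∀ {Q α β} → β < Q → α + β ≤ Q →
                      Q + (Q ^ 2 ∸ (α + β * suc Q)) ≡ suc Q * (Q ∸ (α + β)) + Q * α
  exponent-identity {Q} {α} {β} β<Q α+β≤Q = ℕP.+-cancelʳ-≡ _ _ _ (begin-equality
    Q + (Q ^ 2 ∸ x) + x
      ≡⟨ ℕP.+-assoc Q _ x ⟩
    Q + (Q ^ 2 ∸ x + x)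
      ≡⟨ ≡.cong (λ n → Q + n) (ℕP.m∸n+n≡m x≤Q²) ⟩
    Q + Q ^ 2
      ≡⟨ ≡.cong (λ n → Q + n) (Q²≡Q*Q Q) ⟩
    Q + Q * Q
      ≡⟨ ≡.subst (λ Q′ → Q′ + Q′ * Q′ ≡ suc Q′ * d + Q′ * α + (α + β * suc Q′)) Q≡ (expand α β d) ⟩
    suc Q * d + Q * α + x ∎)
    where
    x d : ℕ
    x = α + β * suc Q
    d = Q ∸ (α + β)
    Q≡ : α + β + d ≡ Q
    Q≡ = ℕP.m+[n∸m]≡n α+β≤Q
    expand : ∀ α β d → (α + β + d) + (α + β + d) * (α + β + d)
                       ≡ (1 + (α + β + d)) * d + (α + β + d) * α + (α + β * (1 + (α + β + d)))
    expand = solve-∀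
    x≤Q² : x ≤ Q ^ 2
    x≤Q² = begin
      α + β * suc Q     ≡⟨ regroup α β Q ⟩
      α + β + β * Q     ≤⟨ ℕP.+-monoˡ-≤ (β * Q) α+β≤Q ⟩
      suc β * Q         ≤⟨ ℕP.*-monoˡ-≤ Q β<Q ⟩
      Q * Q             ≡⟨ Q²≡Q*Q Q ⟨
      Q ^ 2             ∎
      where
      regroup : ∀ α β Q → α + β * (1 + Q) ≡ α + β + β * Q
      regroup = solve-∀

  2Q∸s≡q+r : ∀ {Q s} → s < Q → 2 * Q ∸ s ≡ suc Q + (Q ∸ suc s)
  2Q∸s≡q+r {Q} {s} s<Q = ≡.subst (λ Q′ → 2 * Q′ ∸ s ≡ suc Q′ + r) (ℕP.m+[n∸m]≡n s<Q)
    (≡.trans (≡.cong (_∸ s) (expand s r)) (ℕP.m+n∸m≡n s (suc (suc s + r) + r)))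
    where
    r : ℕ
    r = Q ∸ suc s
    expand : ∀ s r → 2 * (1 + s + r) ≡ s + ((2 + s + r) + r)
    expand = solve-∀

  in-row : ∀ {Q α β} → α ≤ Q → β < Q ∸ α → suc α + β ≤ Q
  in-row {Q} {α} {β} α≤Q β<Q∸α = begin
    suc (α + β)   ≡⟨ ≡.cong suc (ℕP.+-comm α β) ⟩
    suc β + α     ≤⟨ ℕP.m≤o∸n⇒m+n≤o (suc β) α≤Q β<Q∸α ⟩
    Q             ∎

  past-row : ∀ {Q α β} → α ≤ Q → Q ∸ α ≤ β → Q < suc α + β
  past-row {Q} {α} {β} α≤Q Q∸α≤β = begin-strict
    Q             ≡⟨ ℕP.m+[n∸m]≡n α≤Q ⟨
    α + (Q ∸ α)   ≤⟨ ℕP.+-monoʳ-≤ α Q∸α≤β ⟩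
    α + β         <⟨ ℕP.n<1+n (α + β) ⟩
    suc α + β     ∎

  2Q∸Q≡Q : ∀ Q → 2 * Q ∸ Q ≡ Q
  2Q∸Q≡Q Q = ≡.trans (ℕP.m+n∸m≡n Q (Q + 0)) (ℕP.+-identityʳ Q)

  Q+Q²≡Q*q : ∀ Q → Q + Q ^ 2 ≡ Q * suc Q
  Q+Q²≡Q*q Q = ≡.trans (≡.cong (λ n → Q + n) (Q²≡Q*Q Q)) (≡.sym (ℕP.*-suc Q Q))

-- q is taken of the form Q′ + 2 so that the q ∸ 1 inside hTerm, hRHS and hDen reduces.
-- q is taken of the form Q′ + 2 so that the q ∸ 1 inside hTerm, hRHS and hDen reduces.
module Identity {p} (p-prime : Prime p) (p≢2 : p ≢ 2) (k Q′ : ℕ) (p^[1+k]≡q : p ℕ.^ suc k ≡ suc (suc Q′)) where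
  open Congruence p
  open PolynomialsModulo p
  open CommutativeRing polynomialRing hiding (zero)
  open FiniteSums semiring
  open RingSums polynomialRing
  open BinomialTheorem commutativeSemiring using (binomial-∑; ^-zeroˡ; frobenius-^)
  open PrimePowerCongruences p-prime
  open IndexArithmetic
  open import Algebra.Properties.Semiring.Exp semiring using (_^_; ^-homo-*; ^-assocʳ)
  open import Algebra.Properties.Semiring.Mult semiring using (_×_; ×-assoc-*; ×-comm-*; ×-congʳ; ×-homo-1)
  open import Algebra.Properties.CommutativeSemiring.Exp commutativeSemiring using (^-distrib-*)
  open import Algebra.Properties.Ring ring using (-‿distribˡ-*; [y-z]x≈yx-zx; -1*x≈-x)
  open import Algebra.Properties.CommutativeSemigroup *-commutativeSemigroup using (x∙yz≈y∙xz)
  open import Relation.Binary.Reasoning.Setoid setoid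
  open import Tactic.RingSolver.Core.AlmostCommutativeRing using (fromCommutativeRing)
  open import Tactic.RingSolver.NonReflective (fromCommutativeRing polynomialRing is-zero?)
    using (solve; _⊜_; Κ; _⊕_; _⊗_; ⊝_)

  Q q : ℕ
  Q = suc Q′
  q = suc Q

  u a V b : Poly
  u = X ^ Q
  a = X ^ q
  V = u ^ q
  b = u + 1#

  X^≈monomial : ∀ e → monomial (+ 1) e ≈ X ^ e
  X^≈monomial e = ≐⇒≋ (≐-sym (X^≐monomial e))

  u^q≈a^Q : V ≈ a ^ Q
  u^q≈a^Q = begin
    (X ^ Q) ^ q     ≈⟨ ^-assocʳ X Q q ⟩
    X ^ (Q ℕ.* q)   ≡⟨ ≡.cong (X ^_) (ℕP.*-comm Q q) ⟩
    X ^ (q ℕ.* Q)   ≈⟨ ^-assocʳ X q Q ⟨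
    (X ^ q) ^ Q     ∎

  Q<p^[1+k] : Q < p ℕ.^ suc k
  Q<p^[1+k] = ≡.subst (Q <_) (≡.sym p^[1+k]≡q) (ℕP.n<1+n Q)

  coefficient : ℕ → ℕ → ℤ
  coefficient α β = + (2 ℕ.^ (α ℕ.+ β) ℕ.* ((2 ℕ.* Q ∸ α ∸ β) C Q)) ℤ.- + ((α ℕ.+ β) C α)

  coefficient-below : ∀ α β → α ℕ.+ β < Q → coefficient α β ≡ₘ ℤ.- + ((α ℕ.+ β) C α)
  coefficient-below α β s<Q =
    ≡ₘ-resp-≡ ≡.refl (ℤP.+-identityˡ _) (+-cong-≡ₘ {c = ℤ.- + ((α ℕ.+ β) C α)} 2^s*C≡0 ≡ₘ-refl)
    where
    s r : ℕ
    s = α ℕ.+ β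
    r = Q ∸ suc s
    [2Q∸s]CQ≡0 : + ((2 ℕ.* Q ∸ α ∸ β) C Q) ≡ₘ + 0
    [2Q∸s]CQ≡0 = ≡ₘ-resp-≡
      (≡.cong (λ n → + (n C Q)) (≡.trans (≡.cong (ℕ._+ r) p^[1+k]≡q)
                                         (≡.sym (≡.trans (ℕP.∸-+-assoc (2 ℕ.* Q) α β) (2Q∸s≡q+r s<Q)))))
      (≡.cong +_ (k>n⇒nCk≡0 (s≤s (ℕP.m∸n≤m Q′ s))))
      ([p^k+r]Cj≡rCj (suc k) r Q Q<p^[1+k])
    2^s*C≡0 : + (2 ℕ.^ s ℕ.* ((2 ℕ.* Q ∸ α ∸ β) C Q)) ≡ₘ + 0
    2^s*C≡0 = ≡ₘ-resp-≡ (≡.sym (ℤP.pos-* (2 ℕ.^ s) _)) (ℤP.*-zeroʳ (+ (2 ℕ.^ s)))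
                        (*-cong-≡ₘ {a = + (2 ℕ.^ s)} ≡ₘ-refl [2Q∸s]CQ≡0)

  coefficient-top : ∀ α β → α ℕ.+ β ≡ Q → coefficient α β ≡ₘ + 1 ℤ.- + (Q C α)
  coefficient-top α β s≡Q =
    ≡ₘ-resp-≡ (≡.sym coefficient≡) ≡.refl
      (+-cong-≡ₘ {c = ℤ.- + (Q C α)} (2^[p^k-1]≡1 p≢2 (suc k) p^[1+k]≡q) ≡ₘ-refl)
    where
    coefficient≡ : coefficient α β ≡ + (2 ℕ.^ Q) ℤ.- + (Q C α)
    coefficient≡ = ≡.trans
      (≡.cong₂ (λ s n → + (2 ℕ.^ s ℕ.* (n C Q)) ℤ.- + (s C α)) s≡Q
               (≡.trans (ℕP.∸-+-assoc (2 ℕ.* Q) α β) (≡.trans (≡.cong (2 ℕ.* Q ∸_) s≡Q) (2Q∸Q≡Q Q))))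
      (≡.cong (λ n → + n ℤ.- + (Q C α)) (≡.trans (≡.cong (2 ℕ.^ Q ℕ.*_) (nCn≡1 Q)) (ℕP.*-identityʳ _)))

  E : ℕ → ℕ → Poly
  E s α = a ^ (Q ∸ s) * u ^ α

  term : ℕ → ℕ → Poly
  term α β = constant (coefficient α β) * E (α ℕ.+ β) α

  constant*≈× : ∀ n F → constant (+ n) * F ≈ n × F
  constant*≈× n F = trans (*-congʳ (constant≈× n)) (trans (×-assoc-* n 1# F) (×-congʳ n (*-identityˡ F)))

  term-below : ∀ α β → α ℕ.+ β < Q → term α β ≈ - (((α ℕ.+ β) C α) × E (α ℕ.+ β) α)
  term-below α β s<Q = begin
    constant (coefficient α β) * F         ≈⟨ *-congʳ (constant-cong (coefficient-below α β s<Q)) ⟩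
    - constant (+ ((α ℕ.+ β) C α)) * F     ≈⟨ -‿distribˡ-* (constant (+ ((α ℕ.+ β) C α))) F ⟨
    - (constant (+ ((α ℕ.+ β) C α)) * F)   ≈⟨ -‿cong (constant*≈× ((α ℕ.+ β) C α) F) ⟩
    - (((α ℕ.+ β) C α) × F)                ∎
    where F = E (α ℕ.+ β) α

  term-top : ∀ α β → α ℕ.+ β ≡ Q → term α β ≈ E Q α - (Q C α) × E Q α
  term-top α β s≡Q = begin
    constant (coefficient α β) * E (α ℕ.+ β) α
      ≡⟨ ≡.cong (λ s → constant (coefficient α β) * E s α) s≡Q ⟩
    constant (coefficient α β) * E Q α
      ≈⟨ *-congʳ (constant-cong (coefficient-top α β s≡Q)) ⟩
    (1# - constant (+ (Q C α))) * E Q α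
      ≈⟨ [y-z]x≈yx-zx (E Q α) 1# (constant (+ (Q C α))) ⟩
    1# * E Q α - constant (+ (Q C α)) * E Q α
      ≈⟨ +-cong (*-identityˡ (E Q α)) (-‿cong (constant*≈× (Q C α) (E Q α))) ⟩
    E Q α - (Q C α) × E Q α ∎

  a^[Q∸Q]*F≈F : ∀ F → a ^ (Q ∸ Q) * F ≈ F
  a^[Q∸Q]*F≈F F rewrite ℕP.n∸n≡0 Q = *-identityˡ F

  G H : Poly
  G = ∑ q (u ^_)
  H = ∑ q (λ s → a ^ (Q ∸ s) * b ^ s)

  binomial-scaled : ∀ s c → ∑ (suc s) (λ α → (s C α) × (c * u ^ α)) ≈ c * b ^ s
  binomial-scaled s c = begin
    ∑ (suc s) (λ α → (s C α) × (c * u ^ α))  ≈⟨ ∑-cong (suc s) {g = λ α → c * summand α} (λ α _ → pull-out α) ⟩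
    ∑ (suc s) (λ α → c * summand α)          ≈⟨ ∑-distribˡ (suc s) c summand ⟨
    c * ∑ (suc s) summand                    ≈⟨ *-congˡ {c} (binomial-∑ s u 1#) ⟨
    c * b ^ s                                ∎
    where
    summand : ℕ → Poly
    summand α = (s C α) × (u ^ α * 1# ^ (s ∸ α))
    pull-out : ∀ α → (s C α) × (c * u ^ α) ≈ c * summand α
    pull-out α = begin
      (s C α) × (c * u ^ α)
        ≈⟨ ×-congʳ (s C α) (*-congˡ {c} (trans (*-congˡ {u ^ α} (^-zeroˡ (s ∸ α))) (*-identityʳ (u ^ α)))) ⟨
      (s C α) × (c * (u ^ α * 1# ^ (s ∸ α)))
        ≈⟨ ×-comm-* (s C α) c (u ^ α * 1# ^ (s ∸ α)) ⟨
      c * summand α ∎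

  diagonal-below : ∀ s → s < Q → ∑ (suc s) (λ α → term α (s ∸ α)) ≈ - (a ^ (Q ∸ s) * b ^ s)
  diagonal-below s s<Q = begin
    ∑ (suc s) (λ α → term α (s ∸ α))
      ≈⟨ ∑-cong (suc s) {f = λ α → term α (s ∸ α)} {g = λ α → - ((s C α) × E s α)}
                (λ α α<1+s → along-diagonal {α} (ℕP.m+[n∸m]≡n (ℕP.≤-pred α<1+s))) ⟩
    ∑ (suc s) (λ α → - ((s C α) × E s α))       ≈⟨ ∑-neg (suc s) (λ α → (s C α) × E s α) ⟩
    - ∑ (suc s) (λ α → (s C α) × E s α)         ≈⟨ -‿cong (binomial-scaled s (a ^ (Q ∸ s))) ⟩
    - (a ^ (Q ∸ s) * b ^ s)                     ∎
    where
    along-diagonal : ∀ {α} → α ℕ.+ (s ∸ α) ≡ s → term α (s ∸ α) ≈ - ((s C α) × E s α)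
    along-diagonal {α} α+β≡s = ≡.subst (λ s′ → term α (s ∸ α) ≈ - ((s′ C α) × E s′ α)) α+β≡s
      (term-below α (s ∸ α) (≡.subst (_< Q) (≡.sym α+β≡s) s<Q))

  diagonal-top : ∑ q (λ α → term α (Q ∸ α)) ≈ G - b ^ Q
  diagonal-top = begin
    ∑ q (λ α → term α (Q ∸ α))
      ≈⟨ ∑-cong q {f = λ α → term α (Q ∸ α)} {g = λ α → E Q α - (Q C α) × E Q α}
                (λ α α<q → term-top α (Q ∸ α) (ℕP.m+[n∸m]≡n (ℕP.≤-pred α<q))) ⟩
    ∑ q (λ α → E Q α - (Q C α) × E Q α)                 ≈⟨ ∑-- q (E Q) (λ α → (Q C α) × E Q α) ⟩
    ∑ q (E Q) - ∑ q (λ α → (Q C α) × E Q α)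
      ≈⟨ +-cong (∑-cong q (λ α _ → a^[Q∸Q]*F≈F (u ^ α))) (-‿cong (binomial-scaled Q (a ^ (Q ∸ Q)))) ⟩
    G - a ^ (Q ∸ Q) * b ^ Q                             ≈⟨ +-congˡ {G} (-‿cong (a^[Q∸Q]*F≈F (b ^ Q))) ⟩
    G - b ^ Q                                           ∎

  triangle≈G-H : ∑ q (λ s → ∑ (suc s) (λ α → term α (s ∸ α))) ≈ G - H
  triangle≈G-H = begin
    ∑ q diagonal
      ≈⟨ ∑-last Q diagonal ⟩
    ∑ Q diagonal + diagonal Q
      ≈⟨ +-cong (∑-cong Q {f = diagonal} {g = λ s → - h s} diagonal-below) diagonal-top ⟩
    ∑ Q (λ s → - h s) + (G - b ^ Q)
      ≈⟨ +-congʳ {G - b ^ Q} (∑-neg Q h) ⟩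
    - ∑ Q h + (G - b ^ Q)
      ≈⟨ solve 3 (λ S G B → (⊝ S ⊕ (G ⊕ ⊝ B)) ⊜ (G ⊕ ⊝ (S ⊕ B))) refl (∑ Q h) G (b ^ Q) ⟩
    G - (∑ Q h + b ^ Q)
      ≈⟨ +-congˡ {G} (-‿cong (+-congˡ {∑ Q h} (a^[Q∸Q]*F≈F (b ^ Q)))) ⟨
    G - (∑ Q h + h Q)
      ≈⟨ +-congˡ {G} (-‿cong (∑-last Q h)) ⟨
    G - H ∎
    where
    diagonal h : ℕ → Poly
    diagonal s = ∑ (suc s) (λ α → term α (s ∸ α))
    h s = a ^ (Q ∸ s) * b ^ s

  inRange : ℕ → ℕ → Bool
  inRange α β = (0 <ᵇ α ℕ.+ β) ∧ (α ℕ.+ β ≤ᵇ Q)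

  inRange⇒≤ : ∀ {α β} → T (inRange α β) → α ℕ.+ β ≤ Q
  inRange⇒≤ {α} {β} in-range = ℕP.≤ᵇ⇒≤ (α ℕ.+ β) Q (proj₂ (Equivalence.to T-∧ in-range))

  restricted : ℕ → ℕ → Poly
  restricted α β = if inRange α β then term α β else 0#

  u*X^e≈E : ∀ {α β} → β < Q → α ℕ.+ β ≤ Q → u * X ^ (Q ℕ.^ 2 ∸ (α ℕ.+ β ℕ.* q)) ≈ E (α ℕ.+ β) α
  u*X^e≈E {α} {β} β<Q α+β≤Q = begin
    X ^ Q * X ^ e                    ≈⟨ ^-homo-* X Q e ⟨
    X ^ (Q ℕ.+ e)                    ≡⟨ ≡.cong (X ^_) (exponent-identity β<Q α+β≤Q) ⟩
    X ^ (q ℕ.* d ℕ.+ Q ℕ.* α)        ≈⟨ ^-homo-* X (q ℕ.* d) (Q ℕ.* α) ⟩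
    X ^ (q ℕ.* d) * X ^ (Q ℕ.* α)    ≈⟨ *-cong (^-assocʳ X q d) (^-assocʳ X Q α) ⟨
    a ^ d * u ^ α                    ∎
    where
    e d : ℕ
    e = Q ℕ.^ 2 ∸ (α ℕ.+ β ℕ.* q)
    d = Q ∸ (α ℕ.+ β)

  u*hTerm≈restricted : ∀ α β → β < Q → u * hTerm q α β ≈ restricted α β
  u*hTerm≈restricted α β β<Q = u*-if (inRange α β) λ in-range → begin
    u * monomial c e               ≈⟨ *-congˡ {u} (monomial≈ c e) ⟩
    u * (constant c * X ^ e)       ≈⟨ x∙yz≈y∙xz u (constant c) (X ^ e) ⟩
    constant c * (u * X ^ e)       ≈⟨ *-congˡ {constant c} (u*X^e≈E {α} β<Q (inRange⇒≤ {α} in-range)) ⟩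
    term α β                       ∎
    where
    c : ℤ
    c = coefficient α β
    e : ℕ
    e = Q ℕ.^ 2 ∸ (α ℕ.+ β ℕ.* q)
    u*-if : ∀ c {F F′} → (T c → u * F ≈ F′) → u * (if c then F else []) ≈ (if c then F′ else 0#)
    u*-if true  u*F≈F′ = u*F≈F′ _
    u*-if false _      = zeroʳ u

  rhs-sum : Poly
  rhs-sum = sumP (concatMap (λ α → map (λ β → hTerm q α β) (upTo Q)) (upTo q))

  u*rhs-sum≈restricted : u * rhs-sum ≈ ∑ q (λ α → ∑ Q (restricted α))
  u*rhs-sum≈restricted = begin
    u * rhs-sum                               ≈⟨ *-congˡ {u} (sumP-concatMap-applyUpTo q id row) ⟩
    u * ∑ q (λ α → sumP (row α))
      ≈⟨ *-congˡ {u} (∑-cong q {g = λ α → ∑ Q (hTerm q α)} (λ α _ → reflexive (sumP-map-applyUpTo Q id (hTerm q α)))) ⟩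
    u * ∑ q (λ α → ∑ Q (hTerm q α))           ≈⟨ ∑-distribˡ q u (λ α → ∑ Q (hTerm q α)) ⟩
    ∑ q (λ α → u * ∑ Q (hTerm q α))
      ≈⟨ ∑-cong q {g = λ α → ∑ Q (restricted α)}
                (λ α _ → trans (∑-distribˡ Q u (hTerm q α)) (∑-cong Q {g = restricted α} (u*hTerm≈restricted α))) ⟩
    ∑ q (λ α → ∑ Q (restricted α))            ∎
    where
    row : ℕ → List Poly
    row α = map (λ β → hTerm q α β) (upTo Q)

  if-true : ∀ {c} {F F′ : Poly} → c ≡ true → (if c then F else F′) ≈ F
  if-true ≡.refl = refl

  if-false : ∀ {c} {F F′ : Poly} → c ≡ false → (if c then F else F′) ≈ F′
  if-false ≡.refl = refl

  row-restricted : ∀ α′ → α′ < Q → ∑ Q (restricted (suc α′)) ≈ ∑ (Q ∸ α′) (term (suc α′))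
  row-restricted α′ α′<Q = ∑-vanishing-tail (restricted (suc α′)) (term (suc α′)) (ℕP.m∸n≤m Q α′) inside outside
    where
    inside : ∀ β → β < Q ∸ α′ → restricted (suc α′) β ≈ term (suc α′) β
    inside β β<Q∸α′ = if-true (dec-true (suc α′ ℕ.+ β ℕ.≤? Q) (in-row (ℕP.<⇒≤ α′<Q) β<Q∸α′))
    outside : ∀ β → Q ∸ α′ ≤ β → β < Q → restricted (suc α′) β ≈ 0#
    outside β Q∸α′≤β _ = if-false (dec-false (suc α′ ℕ.+ β ℕ.≤? Q) (ℕP.<⇒≱ (past-row (ℕP.<⇒≤ α′<Q) Q∸α′≤β)))

  -- The restriction 0 < α + β ≤ Q, β < Q misses exactly the corners (0, 0) and (0, Q) of the triangle.
  restricted+corners≈triangle :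
    ∑ q (λ α → ∑ Q (restricted α)) + term 0 0 + term 0 Q ≈ ∑ q (λ α → ∑ (q ∸ α) (term α))
  restricted+corners≈triangle = begin
    (∑ Q (restricted 0) + ∑ Q (λ α′ → ∑ Q (restricted (suc α′)))) + term 0 0 + term 0 Q
      ≈⟨ +-congʳ {term 0 Q} (+-congʳ {term 0 0}
           (+-cong first-row (∑-cong Q {g = λ α′ → ∑ (Q ∸ α′) (term (suc α′))} row-restricted))) ⟩
    ((0# + A) + R) + term 0 0 + term 0 Q
      ≈⟨ solve 4 (λ A R x y → (((Κ 0# ⊕ A) ⊕ R) ⊕ x ⊕ y) ⊜ ((x ⊕ (A ⊕ y)) ⊕ R)) refl A R (term 0 0) (term 0 Q) ⟩
    (term 0 0 + (A + term 0 Q)) + R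
      ≈⟨ +-congʳ {R} (+-congˡ {term 0 0} (∑-last Q′ (term 0 ∘ suc))) ⟨
    ∑ q (λ α → ∑ (q ∸ α) (term α)) ∎
    where
    A R : Poly
    A = ∑ Q′ (term 0 ∘ suc)
    R = ∑ Q (λ α′ → ∑ (Q ∸ α′) (term (suc α′)))
    first-row : ∑ Q (restricted 0) ≈ 0# + A
    first-row = +-congˡ {0#} (∑-cong Q′ {g = term 0 ∘ suc} (λ β β<Q′ →
      if-true (dec-true (suc β ℕ.≤? Q) (s≤s (ℕP.<⇒≤ β<Q′)))))

  term-corner₀ : term 0 0 ≈ - a ^ Q
  term-corner₀ = trans (term-below 0 0 (s≤s z≤n)) (-‿cong (trans (×-homo-1 (E 0 0)) (*-identityʳ (a ^ Q))))

  term-cornerQ : term 0 Q ≈ 0#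
  term-cornerQ = trans (term-top 0 Q ≡.refl) (trans (+-congˡ {E Q 0} (-‿cong (×-homo-1 (E Q 0)))) (-‿inverseʳ (E Q 0)))

  u*rhs-sum≈G-H+V : u * rhs-sum ≈ (G - H) + V
  u*rhs-sum≈G-H+V = begin
    u * rhs-sum
      ≈⟨ u*rhs-sum≈restricted ⟩
    R
      ≈⟨ solve 3 (λ R x y → R ⊜ (((R ⊕ x) ⊕ y) ⊕ ⊝ x ⊕ ⊝ y)) refl R (term 0 0) (term 0 Q) ⟩
    (R + term 0 0 + term 0 Q) - term 0 0 - term 0 Q
      ≈⟨ +-congʳ {x = - term 0 Q} (+-congʳ {x = - term 0 0} triangle) ⟩
    (G - H) - term 0 0 - term 0 Q
      ≈⟨ +-cong (+-congˡ {G - H} (-‿cong term-corner₀)) (-‿cong term-cornerQ) ⟩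
    (G - H) - - a ^ Q - 0#
      ≈⟨ solve 2 (λ x y → ((x ⊕ ⊝ (⊝ y)) ⊕ ⊝ Κ 0#) ⊜ (x ⊕ y)) refl (G - H) (a ^ Q) ⟩
    (G - H) + a ^ Q
      ≈⟨ +-congˡ {G - H} u^q≈a^Q ⟨
    (G - H) + V ∎
    where
    R : Poly
    R = ∑ q (λ α → ∑ Q (restricted α))
    triangle : R + term 0 0 + term 0 Q ≈ G - H
    triangle = trans restricted+corners≈triangle (trans (∑-triangle Q term) triangle≈G-H)

  u*hRHS≈ : u * hRHS q ≈ V + ((G - H) + V)
  u*hRHS≈ = begin
    u * (monomial (+ 1) (Q ℕ.^ 2) + rhs-sum)            ≈⟨ distribˡ u (monomial (+ 1) (Q ℕ.^ 2)) rhs-sum ⟩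
    u * monomial (+ 1) (Q ℕ.^ 2) + u * rhs-sum          ≈⟨ +-cong u*t^[Q²]≈V u*rhs-sum≈G-H+V ⟩
    V + ((G - H) + V)                                   ∎
    where
    u*t^[Q²]≈V : u * monomial (+ 1) (Q ℕ.^ 2) ≈ V
    u*t^[Q²]≈V = begin
      u * monomial (+ 1) (Q ℕ.^ 2)    ≈⟨ *-congˡ {u} (X^≈monomial (Q ℕ.^ 2)) ⟩
      X ^ Q * X ^ (Q ℕ.^ 2)           ≈⟨ ^-homo-* X Q (Q ℕ.^ 2) ⟨
      X ^ (Q ℕ.+ Q ℕ.^ 2)             ≡⟨ ≡.cong (X ^_) (Q+Q²≡Q*q Q) ⟩
      X ^ (Q ℕ.* q)                   ≈⟨ ^-assocʳ X Q q ⟨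
      V                               ∎

  hNum≈ : hNum q ≈ (X - (1# + 1#)) * (u * V - 1#)
  hNum≈ = *-cong t-2 (+-congʳ {x = - 1#} t^[q²-1]≈uV)
    where
    t-2 : (-[1+ 1 ] ∷ + 1 ∷ []) ≈ X - (1# + 1#)
    t-2 = ≐⇒≋ (mk≐ λ { zero → ≡.refl ; (suc zero) → ≡.refl ; (suc (suc n)) → ≡.refl })
    t^[q²-1]≈uV : monomial (+ 1) (q ℕ.* q ∸ 1) ≈ u * V
    t^[q²-1]≈uV = trans (X^≈monomial (Q ℕ.+ Q ℕ.* q)) (trans (^-homo-* X Q (Q ℕ.* q)) (*-congˡ {u} (sym (^-assocʳ X Q q))))

  hDen≈ : hDen q ≈ (u - 1#) * (a - u - 1#)
  hDen≈ = *-cong (+-congʳ {x = - 1#} (X^≈monomial Q))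
                 (+-congʳ {x = - 1#} (+-cong (X^≈monomial q) (trans (monomial≈ -[1+ 0 ] Q) (-1*x≈-x u))))

  [u-1]G≈V-1 : (u - 1#) * G ≈ V - 1#
  [u-1]G≈V-1 = ∑-geometric-1 Q u

  [b-a]H≈V+1-aV : (b - a) * H ≈ (V + 1#) - a * V
  [b-a]H≈V+1-aV = trans (∑-geometric Q a b) (+-cong b^q≈V+1 (-‿cong (^-distrib-* X u q)))
    where
    b^q≈V+1 : b ^ q ≈ V + 1#
    b^q≈V+1 = trans (≡.subst (λ n → b ^ n ≈ u ^ n + 1# ^ n) p^[1+k]≡q (frobenius-^ p-prime char-m (suc k) u 1#))
                    (+-congˡ {V} (^-zeroˡ q))

  u*hNum≈u*[hDen*hRHS] : u * hNum q ≈ u * (hDen q * hRHS q)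
  u*hNum≈u*[hDen*hRHS] = begin
    u * hNum q
      ≈⟨ *-congˡ {u} hNum≈ ⟩
    u * ((X - (1# + 1#)) * (u * V - 1#))
      ≈⟨ solve 3 (λ t u V → (u ⊗ ((t ⊕ ⊝ (Κ 1# ⊕ Κ 1#)) ⊗ (u ⊗ V ⊕ ⊝ Κ 1#)))
                   ⊜ ((Κ 1# ⊕ Κ 1#) ⊗ V ⊗ ((u ⊕ ⊝ Κ 1#) ⊗ (t ⊗ u ⊕ ⊝ u ⊕ ⊝ Κ 1#))
                      ⊕ (t ⊗ u ⊕ ⊝ u ⊕ ⊝ Κ 1#) ⊗ (V ⊕ ⊝ Κ 1#)
                      ⊕ (u ⊕ ⊝ Κ 1#) ⊗ ((V ⊕ Κ 1#) ⊕ ⊝ (t ⊗ u ⊗ V)))) refl X u V ⟩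
    (1# + 1#) * V * D + (a - u - 1#) * (V - 1#) + (u - 1#) * ((V + 1#) - a * V)
      ≈⟨ +-cong (+-congˡ {(1# + 1#) * V * D} (*-congˡ {a - u - 1#} [u-1]G≈V-1)) (*-congˡ {u - 1#} [b-a]H≈V+1-aV) ⟨
    (1# + 1#) * V * D + (a - u - 1#) * ((u - 1#) * G) + (u - 1#) * ((b - a) * H)
      ≈⟨ solve 5 (λ t u V G H →
           ((Κ 1# ⊕ Κ 1#) ⊗ V ⊗ ((u ⊕ ⊝ Κ 1#) ⊗ (t ⊗ u ⊕ ⊝ u ⊕ ⊝ Κ 1#))
            ⊕ (t ⊗ u ⊕ ⊝ u ⊕ ⊝ Κ 1#) ⊗ ((u ⊕ ⊝ Κ 1#) ⊗ G)
            ⊕ (u ⊕ ⊝ Κ 1#) ⊗ (((u ⊕ Κ 1#) ⊕ ⊝ (t ⊗ u)) ⊗ H))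
           ⊜ (((u ⊕ ⊝ Κ 1#) ⊗ (t ⊗ u ⊕ ⊝ u ⊕ ⊝ Κ 1#)) ⊗ (V ⊕ ((G ⊕ ⊝ H) ⊕ V)))) refl X u V G H ⟩
    D * (V + ((G - H) + V))
      ≈⟨ *-cong hDen≈ u*hRHS≈ ⟨
    hDen q * (u * hRHS q)
      ≈⟨ x∙yz≈y∙xz (hDen q) u (hRHS q) ⟩
    u * (hDen q * hRHS q) ∎
    where
    D : Poly
    D = (u - 1#) * (a - u - 1#)

  hNum≈hDen*hRHS : hNum q ≈ hDen q * hRHS q
  hNum≈hDen*hRHS = X^*-cancelˡ Q u*hNum≈u*[hDen*hRHS]

2≤p^[1+k] : ∀ {p} → Prime p → ∀ k → 2 ≤ p ℕ.^ suc k
2≤p^[1+k] {p} p-prime k = ℕP.≤-trans (prime≥2 p-prime) (ℕP.m≤m*n p (p ℕ.^ k) {{ℕP.m^n≢0 p k {{prime⇒nonZero p-prime}}}})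

lemma2p3 : (p q : ℕ) → Prime p → p ≢ 2 → ∃[ k ] (q ≡ p ℕ.^ suc k) →
    hNum q ≡[mod p ] (hDen q *P hRHS q)
lemma2p3 p q p-prime p≢2 (k , q≡p^[1+k]) with ≡.subst (2 ≤_) (≡.sym q≡p^[1+k]) (2≤p^[1+k] p-prime k)
... | s≤s (s≤s {n = Q′} _) = λ n → ℤS.∣⇒∣ᵤ (m∣a-b (coeff-≡ₘ identity n))
  where
  open Congruence p using (m∣a-b)
  open PolynomialsModulo p using (_≋_; coeff-≡ₘ)
  identity : hNum (suc (suc Q′)) ≋ hDen (suc (suc Q′)) *P hRHS (suc (suc Q′))
  identity = Identity.hNum≈hDen*hRHS p-prime p≢2 k Q′ (≡.sym q≡p^[1+k])
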